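{- Let $D$ be a digraph such that every proper induced subdigraph of $D$ satisfies the $\alpha$-property, and let $S$ be a maximum stable set of $D$. Let $P=v_1v_2\dots v_k$, $k>1$, be a path of $D$ with $(V(P)\setminus\{v_1\})\cap S=\emptyset$. If there is a vertex $u\in V(D)\setminus V(P)$ such that $v_k\to u$ and $N^-(u)\subseteq V(P)$, then $D$ admits an $S$-path partition.
   Context: Digraphs are finite, loopless, without multiple arcs (digons allowed). $u\to v$ means $uv$ is an arc; $N^-(u)$ is the set of in-neighbours of $u$. A stable set is a set of pairwise non-adjacent vertices. A path partition is a collection of vertex-disjoint (directed) paths covering $V(D)$. For a stable set $S$, an $S$-path partition is a path partition in which each path contains exactly one vertex of $S$. A digraph satisfies the $\alpha$-property if for every maximum stable set $S$ it admits an $S$-path partition. -}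

module Defs where

open import Data.Nat using (ℕ; _≤_)
open import Data.Fin using (Fin)
open import Data.Fin.Subset using (Subset; _∈_; _∉_; ∣_∣)
open import Data.List using (List; []; _∷_; concat)
open import Data.List.Membership.Propositional using () renaming (_∈_ to _∈ₗ_)
open import Data.Sum using (_⊎_)
open import Data.List.Relation.Unary.All using (All)
open import Data.List.Relation.Unary.Unique.Propositional using (Unique)
open import Data.List.Relation.Unary.Linked using (Linked)
open import Data.Product using (Σ; _×_; ∃)
open import Function.Bundles using (_⇔_)
open import Relation.Binary.PropositionalEquality using (_≡_)
open import Relation.Nullary using (¬_)

-- A (finite, loopless, simple) digraph on vertex set Fin n.
-- Multiple arcs cannot occur (arcs form a relation); digons are allowed.
record Digraph (n : ℕ) : Set₁ where
  field
    _⇒_      : Fin n → Fin n → Set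
    loopless : ∀ v → ¬ (v ⇒ v)

module _ {n : ℕ} (D : Digraph n) where
  open Digraph D

  Adjacent : Fin n → Fin n → Set
  Adjacent u v = (u ⇒ v) ⊎ (v ⇒ u)

  -- Everything below is relative to a vertex set X; the induced
  -- subdigraph D[X] has vertex set X and the arcs of D between them.

  IsStableIn : Subset n → Subset n → Set
  IsStableIn X S = (∀ v → v ∈ S → v ∈ X) ×
                   (∀ u v → u ∈ S → v ∈ S → ¬ Adjacent u v)

  IsMaxStableIn : Subset n → Subset n → Set
  IsMaxStableIn X S = IsStableIn X S × (∀ T → IsStableIn X T → ∣ T ∣ ≤ ∣ S ∣)

  IsPath : List (Fin n) → Set
  IsPath p = ¬ (p ≡ []) × Unique p × Linked _⇒_ p

  IsPathPartitionIn : Subset n → List (List (Fin n)) → Set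
  IsPathPartitionIn X ps =
    All IsPath ps × Unique (concat ps) × (∀ v → (v ∈ₗ concat ps) ⇔ (v ∈ X))

  ExactlyOneIn : Subset n → List (Fin n) → Set
  ExactlyOneIn S p = (∃ λ s → s ∈ₗ p × s ∈ S) ×
                     (∀ a b → a ∈ₗ p → a ∈ S → b ∈ₗ p → b ∈ S → a ≡ b)

  IsSPathPartitionIn : Subset n → Subset n → List (List (Fin n)) → Set
  IsSPathPartitionIn X S ps = IsPathPartitionIn X ps × All (ExactlyOneIn S) ps

  AlphaPropertyIn : Subset n → Set
  AlphaPropertyIn X = ∀ S → IsMaxStableIn X S →
                      ∃ λ ps → IsSPathPartitionIn X S ps

  Proper : Subset n → Set
  Proper X = ∃ λ v → v ∉ X

-- Delete the vertices L = v₂ … vₖ of P. The rest is a proper induced subdigraph in which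
-- S (which avoids L) is still a maximum stable set, so it has an S-path partition. The
-- vertex u survives, and its only possible in-neighbour on its path is v₁, because every
-- other in-neighbour of u lies in L. Inserting L just before u (after v₁, or at the front
-- of the path) gives a path again, since vₖ → u, and adds no vertex of S.
module Submission where

open import Defs
open import Data.Nat using (ℕ)
open import Data.Fin using (Fin; _≟_)
open import Data.Fin.Subset using (Subset; _∈_; _∉_; ⊤; ⊥; ⁅_⁆; _∪_; ∁)
open import Data.Fin.Subset.Properties using (∈⊤; ∉⊥; x∈⁅x⁆; x∈⁅y⁆⇒x≡y; x∈p∪q⁺; x∈p∪q⁻; x∉p⇒x∈∁p; x∈∁p⇒x∉p)
open import Data.List using (List; []; _∷_; _∷ʳ_; _++_; concat)
open import Data.List.Membership.Propositional using () renaming (_∈_ to _∈ₗ_; _∉_ to _∉ₗ_)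
open import Data.List.Membership.Propositional.Properties using (∈-++⁺ˡ; ∈-++⁺ʳ; ∈-++⁻; ∈-concat⁺′)
import Data.List.Membership.DecPropositional as DecMembership
open import Data.List.Relation.Unary.All as All using (All; []; _∷_)
open import Data.List.Relation.Unary.Any as Any using (here; there)
open import Data.List.Relation.Unary.Linked as Linked using (Linked; []; [-]; _∷_)
open import Data.List.Relation.Unary.Unique.Propositional using (Unique; _∷_)
import Data.List.Relation.Unary.Unique.Propositional.Properties as Unique
open import Data.List.Relation.Binary.Disjoint.Propositional using (Disjoint)
open import Data.List.Relation.Binary.Permutation.Propositional using (_↭_; ↭-refl; ↭-sym; ↭-trans; prep; ↭⇒↭ₛ)
open import Data.List.Relation.Binary.Permutation.Propositional.Properties using (shift; shifts; ++⁺ˡ; ++⁺ʳ; ∈-resp-↭; ++-assoc)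
import Data.List.Relation.Binary.Permutation.Setoid.Properties as PermutationSetoid
open import Data.Product using (∃; _,_)
open import Data.Sum using (_⊎_; inj₁; inj₂)
open import Function using (_∘_; const)
open import Function.Bundles using (_⇔_; mk⇔; Equivalence)
open import Relation.Binary using (Rel)
open import Relation.Binary.PropositionalEquality using (_≡_; refl; sym; setoid)
open import Relation.Binary.Definitions using (DecidableEquality)
open import Relation.Nullary using (¬_; yes; no; contradiction)
open import Relation.Unary using (Pred)

module _ {a} {A : Set a} where

  Unique-resp-↭ : ∀ {xs ys : List A} → xs ↭ ys → Unique xs → Unique ys
  Unique-resp-↭ = PermutationSetoid.Unique-resp-↭ (setoid A) ∘ ↭⇒↭ₛ

  ∈⇒≢[] : ∀ {x : A} {xs} → x ∈ₗ xs → ¬ xs ≡ []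
  ∈⇒≢[] () refl

  module _ {r} {R : Rel A r} where

    Linked-∷ʳ : ∀ xs {x y} → Linked R (xs ∷ʳ x) → R x y → Linked R (xs ∷ʳ x ∷ʳ y)
    Linked-∷ʳ []           _   Rxy = Rxy ∷ [-]
    Linked-∷ʳ (_ ∷ [])     Rxs Rxy = Linked.head Rxs ∷ Rxy ∷ [-]
    Linked-∷ʳ (_ ∷ _ ∷ xs) Rxs Rxy = Linked.head Rxs ∷ Linked-∷ʳ (_ ∷ xs) (Linked.tail Rxs) Rxy

    Linked-++-∷ : ∀ xs {x ys} → Linked R (xs ∷ʳ x) → Linked R (x ∷ ys) → Linked R (xs ++ x ∷ ys)
    Linked-++-∷ []           _   Rys = Rys
    Linked-++-∷ (_ ∷ [])     Rxs Rys = Linked.head Rxs ∷ Rys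
    Linked-++-∷ (_ ∷ _ ∷ xs) Rxs Rys = Linked.head Rxs ∷ Linked-++-∷ (_ ∷ xs) (Linked.tail Rxs) Rys

module Insertion {a} {A : Set a} (_≟ᴬ_ : DecidableEquality A) (u : A) (L : List A) where
  open DecMembership _≟ᴬ_ using (_∈?_)

  insertBefore : List A → List A
  insertBefore []       = []
  insertBefore (x ∷ xs) with x ≟ᴬ u
  ... | yes _ = L ++ x ∷ xs
  ... | no  _ = x ∷ insertBefore xs

  insertBefore-↭ : ∀ {p} → u ∈ₗ p → insertBefore p ↭ L ++ p
  insertBefore-↭ {x ∷ xs} u∈p with x ≟ᴬ u
  ... | yes _ = ↭-refl
  ... | no x≢u with u∈p
  ...   | here u≡x   = contradiction (sym u≡x) x≢u
  ...   | there u∈xs = ↭-trans (prep x (insertBefore-↭ {xs} u∈xs)) (↭-sym (shift x L xs))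

  module _ {r} {R : Rel A r} {pre : A} (R-pre-L-u : Linked R (pre ∷ L ∷ʳ u)) where

    private
      linked-∷ : ∀ {x xs} → Linked R (x ∷ xs) → (∀ {w} → w ∈ₗ x ∷ xs → R w u → w ≡ pre) →
                 Linked R (x ∷ insertBefore xs)
      linked-∷ {xs = []}     _   _         = [-]
      linked-∷ {x} {y ∷ ys} Rxs only-pre with y ≟ᴬ u
      ... | yes refl with only-pre (here refl) (Linked.head Rxs)
      ...   | refl = Linked-++-∷ (pre ∷ L) R-pre-L-u (Linked.tail Rxs)
      linked-∷ {x} {y ∷ ys} Rxs only-pre | no _ =
        Linked.head Rxs ∷ linked-∷ (Linked.tail Rxs) (only-pre ∘ there)

    insertBefore-Linked : ∀ {p} → Linked R p → (∀ {w} → w ∈ₗ p → R w u → w ≡ pre) →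
                          Linked R (insertBefore p)
    insertBefore-Linked {[]}     _   _        = []
    insertBefore-Linked {x ∷ xs} Rxs only-pre with x ≟ᴬ u
    ... | yes refl = Linked-++-∷ L (Linked.tail R-pre-L-u) Rxs
    ... | no  _    = linked-∷ Rxs only-pre

  insertInto : List (List A) → List (List A)
  insertInto []       = []
  insertInto (p ∷ ps) with u ∈? p
  ... | yes _ = insertBefore p ∷ ps
  ... | no  _ = p ∷ insertInto ps

  concat-insertInto-↭ : ∀ ps → u ∈ₗ concat ps → concat (insertInto ps) ↭ L ++ concat ps
  concat-insertInto-↭ (p ∷ ps) u∈ with u ∈? p
  ... | yes u∈p = ↭-trans (++⁺ʳ (concat ps) (insertBefore-↭ u∈p)) (++-assoc L p (concat ps))
  ... | no  u∉p with ∈-++⁻ p u∈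
  ...   | inj₁ u∈p  = contradiction u∈p u∉p
  ...   | inj₂ u∈ps = ↭-trans (++⁺ˡ p (concat-insertInto-↭ ps u∈ps)) (shifts p L)

  All-insertInto : ∀ {ℓ} {P : Pred (List A) ℓ} {ps} →
                   (∀ {q} → q ∈ₗ ps → u ∈ₗ q → P q → P (insertBefore q)) →
                   All P ps → All P (insertInto ps)
  All-insertInto                  _      []         = []
  All-insertInto {ps = p ∷ ps} insert (Pp ∷ Pps) with u ∈? p
  ... | yes u∈p = insert (here refl) u∈p Pp ∷ Pps
  ... | no  _   = Pp ∷ All-insertInto (insert ∘ there) Pps

module _ {n : ℕ} where

  toSubset : List (Fin n) → Subset n
  toSubset []       = ⊥
  toSubset (x ∷ xs) = ⁅ x ⁆ ∪ toSubset xs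

  ∈-toSubset⇔ : ∀ {v xs} → v ∈ toSubset xs ⇔ v ∈ₗ xs
  ∈-toSubset⇔ = mk⇔ to from
    where
      to : ∀ {v xs} → v ∈ toSubset xs → v ∈ₗ xs
      to {xs = []}     v∈ = contradiction v∈ ∉⊥
      to {xs = x ∷ xs} v∈ with x∈p∪q⁻ ⁅ x ⁆ (toSubset xs) v∈
      ... | inj₁ v∈⁅x⁆ = here (x∈⁅y⁆⇒x≡y x v∈⁅x⁆)
      ... | inj₂ v∈xs  = there (to v∈xs)

      from : ∀ {v xs} → v ∈ₗ xs → v ∈ toSubset xs
      from (here refl)  = x∈p∪q⁺ (inj₁ (x∈⁅x⁆ _))
      from (there v∈xs) = x∈p∪q⁺ (inj₂ (from v∈xs))

  ∈-∁-toSubset⇔ : ∀ {v xs} → v ∈ ∁ (toSubset xs) ⇔ v ∉ₗ xs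
  ∈-∁-toSubset⇔ = mk⇔ (λ v∈ → x∈∁p⇒x∉p v∈ ∘ Equivalence.from ∈-toSubset⇔)
                      (λ v∉ → x∉p⇒x∈∁p (v∉ ∘ Equivalence.to ∈-toSubset⇔))

module _ {n : ℕ} (D : Digraph n) where
  open Digraph D
  open Insertion (_≟_ {n})
  open DecMembership (_≟_ {n}) using (_∈?_)

  IsMaxStableIn-⊆ : ∀ {X S} → IsMaxStableIn D ⊤ S → (∀ v → v ∈ S → v ∈ X) → IsMaxStableIn D X S
  IsMaxStableIn-⊆ ((_ , independent) , maximum) S⊆X =
    (S⊆X , independent) , λ T (_ , T-independent) → maximum T ((λ _ _ → ∈⊤) , T-independent)

  ExactlyOneIn-resp-↭ : ∀ {S xs ys} → xs ↭ ys → ExactlyOneIn D S xs → ExactlyOneIn D S ys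
  ExactlyOneIn-resp-↭ {xs = xs} {ys} xs↭ys ((s , s∈xs , s∈S) , at-most-one) =
    (s , ∈-resp-↭ xs↭ys s∈xs , s∈S) ,
    λ a b a∈ys a∈S b∈ys b∈S → at-most-one a b (back a∈ys) a∈S (back b∈ys) b∈S
    where
      back : ∀ {a} → a ∈ₗ ys → a ∈ₗ xs
      back = ∈-resp-↭ (↭-sym xs↭ys)

  ExactlyOneIn-++⁺ʳ : ∀ {S} L {p} → All (_∉ S) L → ExactlyOneIn D S p → ExactlyOneIn D S (L ++ p)
  ExactlyOneIn-++⁺ʳ {S} L {p} L∩S=∅ ((s , s∈p , s∈S) , at-most-one) =
    (s , ∈-++⁺ʳ L s∈p , s∈S) ,
    λ a b a∈ a∈S b∈ b∈S → at-most-one a b (drop-L a∈ a∈S) a∈S (drop-L b∈ b∈S) b∈S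
    where
      drop-L : ∀ {a} → a ∈ₗ L ++ p → a ∈ S → a ∈ₗ p
      drop-L a∈ a∈S with ∈-++⁻ L a∈
      ... | inj₁ a∈L = contradiction a∈S (All.lookup L∩S=∅ a∈L)
      ... | inj₂ a∈p = a∈p

  IsPath-insertBefore : ∀ {pre u L p} → Linked _⇒_ (pre ∷ L ∷ʳ u) → Unique L → Disjoint L p →
                        u ∈ₗ p → (∀ {w} → w ∈ₗ p → w ⇒ u → w ≡ pre) →
                        IsPath D p → IsPath D (insertBefore u L p)
  IsPath-insertBefore {u = u} {L} pre-L-u L-unique L∩p=∅ u∈p only-pre (_ , p-unique , p-linked) =
    ∈⇒≢[] (∈-resp-↭ (↭-sym perm) (∈-++⁺ʳ L u∈p)) ,
    Unique-resp-↭ (↭-sym perm) (Unique.++⁺ L-unique p-unique L∩p=∅) ,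
    insertBefore-Linked u L pre-L-u p-linked only-pre
    where perm = insertBefore-↭ u L u∈p

  IsSPathPartitionIn-insertInto :
    ∀ {S pre u L ps} → Linked _⇒_ (pre ∷ L ∷ʳ u) → Unique L → All (_∉ S) L → u ∉ₗ L →
    (∀ {w} → w ⇒ u → w ≡ pre ⊎ w ∈ₗ L) →
    IsSPathPartitionIn D (∁ (toSubset L)) S ps → IsSPathPartitionIn D ⊤ S (insertInto u L ps)
  IsSPathPartitionIn-insertInto {S} {pre} {u} {L} {ps} pre-L-u L-unique L∩S=∅ u∉L N⁻u
                                ((paths , ps-unique , ps-covers) , exactly-one) =
    (All-insertInto u L extend-path paths ,
     Unique-resp-↭ (↭-sym perm) (Unique.++⁺ L-unique ps-unique (λ (v∈L , v∈ps) → ∉L v∈ps v∈L)) ,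
     λ v → mk⇔ (const ∈⊤) (λ _ → ∈-resp-↭ (↭-sym perm) (covered v))) ,
    All-insertInto u L extend-exactly-one exactly-one
    where
      ∉L : ∀ {v} → v ∈ₗ concat ps → v ∉ₗ L
      ∉L = Equivalence.to ∈-∁-toSubset⇔ ∘ Equivalence.to (ps-covers _)

      ∈ps : ∀ {v} → v ∉ₗ L → v ∈ₗ concat ps
      ∈ps = Equivalence.from (ps-covers _) ∘ Equivalence.from ∈-∁-toSubset⇔

      perm : concat (insertInto u L ps) ↭ L ++ concat ps
      perm = concat-insertInto-↭ u L ps (∈ps u∉L)

      covered : ∀ v → v ∈ₗ L ++ concat ps
      covered v with v ∈? L
      ... | yes v∈L = ∈-++⁺ˡ v∈L
      ... | no  v∉L = ∈-++⁺ʳ L (∈ps v∉L)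

      extend-path : ∀ {q} → q ∈ₗ ps → u ∈ₗ q → IsPath D q → IsPath D (insertBefore u L q)
      extend-path q∈ps u∈q = IsPath-insertBefore pre-L-u L-unique
        (λ (v∈L , v∈q) → ∉L (∈-concat⁺′ v∈q q∈ps) v∈L) u∈q only-pre
        where
          only-pre : ∀ {w} → w ∈ₗ _ → w ⇒ u → w ≡ pre
          only-pre w∈q w⇒u with N⁻u w⇒u
          ... | inj₁ w≡pre = w≡pre
          ... | inj₂ w∈L   = contradiction w∈L (∉L (∈-concat⁺′ w∈q q∈ps))

      extend-exactly-one : ∀ {q} → q ∈ₗ ps → u ∈ₗ q →
                           ExactlyOneIn D S q → ExactlyOneIn D S (insertBefore u L q)
      extend-exactly-one _ u∈q =
        ExactlyOneIn-resp-↭ (↭-sym (insertBefore-↭ u L u∈q)) ∘ ExactlyOneIn-++⁺ʳ L L∩S=∅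

lemma7 : ∀ {n : ℕ} (D : Digraph n) →
    (∀ X → Proper D X → AlphaPropertyIn D X) →
    ∀ (S : Subset n) → IsMaxStableIn D ⊤ S →
    ∀ (v₁ vₖ : Fin n) (mid : List (Fin n)) →
    IsPath D (v₁ ∷ (mid ∷ʳ vₖ)) →
    All (λ w → w ∉ S) (mid ∷ʳ vₖ) →
    ∀ (u : Fin n) → u ∉ₗ (v₁ ∷ (mid ∷ʳ vₖ)) →
    Digraph._⇒_ D vₖ u →
    (∀ w → Digraph._⇒_ D w u → w ∈ₗ (v₁ ∷ (mid ∷ʳ vₖ))) →
    ∃ λ ps → IsSPathPartitionIn D ⊤ S ps
lemma7 D α-proper S S-max v₁ vₖ mid (_ , _ ∷ L-unique , P-linked) L∩S=∅ u u∉P vₖ⇒u N⁻u⊆P =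
  let ps , ps-partition = α-proper _ X-proper S S-max-X
  in Insertion.insertInto _≟_ u L ps ,
     IsSPathPartitionIn-insertInto D (Linked-∷ʳ (v₁ ∷ mid) P-linked vₖ⇒u) L-unique L∩S=∅
       (u∉P ∘ there) (Any.toSum ∘ N⁻u⊆P _) ps-partition
  where
    L = mid ∷ʳ vₖ

    X-proper : Proper D (∁ (toSubset L))
    X-proper = vₖ , λ vₖ∈X → Equivalence.to ∈-∁-toSubset⇔ vₖ∈X (∈-++⁺ʳ mid (here refl))

    S-max-X : IsMaxStableIn D (∁ (toSubset L)) S
    S-max-X = IsMaxStableIn-⊆ D S-max
      (λ v v∈S → Equivalence.from ∈-∁-toSubset⇔ (λ v∈L → All.lookup L∩S=∅ v∈L v∈S))
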